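{- Let $n\geq 1$ be an integer and $\gamma=(\gamma_{ij})\in SL_2(\mathbb{Z})$. Then $\gamma\in\hat\Gamma(n)$ if and only if $n\mid u_\gamma$.
   Context: $\hat\Gamma(n):=\{\gamma\in SL_2(\mathbb{Z}) : \gamma\equiv\alpha I\bmod n \text{ for some } \alpha \text{ with } \alpha^2\equiv 1\bmod n\}$, the kernel of $SL_2(\mathbb{Z})\to PSL_2(\mathbb{Z}/n\mathbb{Z})$. For $\gamma\in SL_2(\mathbb{Z})$, $u_\gamma:=\gcd(\gamma_{21},\gamma_{11}-\gamma_{22},-\gamma_{12})$ (with $\gcd(0,0,0)=0$). -}

module Defs where

open import Data.Nat as ℕ using (ℕ)
open import Data.Nat.GCD using (gcd)
open import Data.Integer using (ℤ; +_; _-_; -_; _*_; ∣_∣; 1ℤ)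
open import Data.Integer.Divisibility using (_∣_)
open import Data.Product using (Σ; _×_)
open import Relation.Binary.PropositionalEquality using (_≡_)

record SL2Z : Set where
  constructor mkSL2
  field
    a b c d : ℤ
    det≡1  : a * d - b * c ≡ 1ℤ
open SL2Z public

CongMod : ℕ → ℤ → ℤ → Set
CongMod n x y = (+ n) ∣ (x - y)

InGammaHat : ℕ → SL2Z → Set
InGammaHat n γ = Σ ℤ λ α →
  (CongMod n (α * α) (1ℤ)) ×
  (CongMod n (a γ) (α)) × (CongMod n (b γ) (+ 0)) ×
  (CongMod n (c γ) (+ 0)) × (CongMod n (d γ) (α))

-- u_γ = gcd(γ₂₁, γ₁₁ - γ₂₂, -γ₁₂) (nonnegative, gcd(0,0,0) = 0)
u : SL2Z → ℕ
u γ = gcd (gcd ∣ c γ ∣ ∣ a γ - d γ ∣) ∣ - b γ ∣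

module Submission where

-- Plan.  Write γ = (a b ; c d).  Both sides of the equivalence say that γ is
-- scalar modulo n, i.e. n divides c, a - d and b:
--
--   * n ∣ u γ = gcd (gcd ∣c∣ ∣a-d∣) ∣-b∣ iff n divides each of the three
--     arguments of the iterated gcd (`∣gcd³⇔`), and ∣-b∣ = ∣b∣;
--   * γ ∈ Γ̂(n) gives a ≡ α ≡ d, b ≡ 0, c ≡ 0 (mod n), hence scalarity;
--   * conversely a scalar γ lies in Γ̂(n) with α = a: the only condition not
--     immediate is a² ≡ 1, which follows from det γ = 1 through the identity
--     a·a - 1 = a·(a - d) + b·c.

open import Defs
open import Data.Nat using (ℕ; _≥_)
open import Data.Nat.Divisibility using (_∣_; ∣-trans; _∣0)
open import Data.Nat.GCD using (gcd; gcd[m,n]∣m; gcd[m,n]∣n; gcd-greatest)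
open import Data.Integer using (ℤ; +_; _-_; -_; _+_; _*_; ∣_∣; 1ℤ)
open import Data.Integer.Properties using (∣-i∣≡∣i∣)
import Data.Integer.Divisibility.Signed as Signed
open Signed using (∣ᵤ⇒∣; ∣⇒∣ᵤ; ∣m∣n⇒∣m+n; ∣m∣n⇒∣m-n; ∣n⇒∣m*n)
open import Data.Integer.Solver using (module +-*-Solver)
open import Data.Product using (_×_; _,_)
open import Function.Bundles using (_⇔_; mk⇔; Equivalence)
open Equivalence using (to; from)
open import Relation.Binary.PropositionalEquality using (_≡_; refl; sym; cong; subst)
open import Relation.Binary.PropositionalEquality.Properties using (module ≡-Reasoning)

open +-*-Solver

∣gcd³⇔ : ∀ {n x y z} → n ∣ gcd (gcd x y) z ⇔ ((n ∣ x) × (n ∣ y) × (n ∣ z))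
∣gcd³⇔ {x = x} {y} {z} = mk⇔ split (λ (n∣x , n∣y , n∣z) → gcd-greatest (gcd-greatest n∣x n∣y) n∣z)
  where
  split : ∀ {n} → n ∣ gcd (gcd x y) z → (n ∣ x) × (n ∣ y) × (n ∣ z)
  split h = ∣-trans h (∣-trans (gcd[m,n]∣m (gcd x y) z) (gcd[m,n]∣m x y))
          , ∣-trans h (∣-trans (gcd[m,n]∣m (gcd x y) z) (gcd[m,n]∣n x y))
          , ∣-trans h (gcd[m,n]∣n (gcd x y) z)

congMod⇔∣ : ∀ {n x y} → CongMod n x y ⇔ (+ n) Signed.∣ (x - y)
congMod⇔∣ {x = x} {y} = mk⇔ (∣ᵤ⇒∣ {i = x - y}) ∣⇒∣ᵤ

congMod0⇔∣ : ∀ {n x} → CongMod n x (+ 0) ⇔ (+ n) Signed.∣ x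
congMod0⇔∣ {n} {x} = mk⇔ (λ h → subst (+ n Signed.∣_) x-0≡x (∣ᵤ⇒∣ h))
                         (λ h → ∣⇒∣ᵤ (subst (+ n Signed.∣_) (sym x-0≡x) h))
  where
  x-0≡x : x - + 0 ≡ x
  x-0≡x = solve 1 (λ x → x :- con (+ 0) := x) refl x

congMod-refl : ∀ n x → CongMod n x x
congMod-refl n x = subst (λ t → n ∣ ∣ t ∣) (solve 1 (λ x → con (+ 0) := x :- x) refl x) (n ∣0)

congMod-sym : ∀ {n x y} → CongMod n x y → CongMod n y x
congMod-sym {n} {x} {y} h = subst (n ∣_) ∣x-y∣≡∣y-x∣ h
  where
  open ≡-Reasoning
  ∣x-y∣≡∣y-x∣ : ∣ x - y ∣ ≡ ∣ y - x ∣
  ∣x-y∣≡∣y-x∣ = begin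
    ∣ x - y ∣     ≡⟨ sym (∣-i∣≡∣i∣ (x - y)) ⟩
    ∣ - (x - y) ∣ ≡⟨ cong ∣_∣ (solve 2 (λ x y → :- (x :- y) := y :- x) refl x y) ⟩
    ∣ y - x ∣     ∎

congMod-common⇒∣ : ∀ {n x y α} → CongMod n x α → CongMod n y α → (+ n) Signed.∣ (x - y)
congMod-common⇒∣ {n} {x} {y} {α} x≡α y≡α =
  subst (+ n Signed.∣_) (solve 3 (λ x y α → (x :- α) :- (y :- α) := x :- y) refl x y α)
        (∣m∣n⇒∣m-n (∣ᵤ⇒∣ {i = x - α} x≡α) (∣ᵤ⇒∣ {i = y - α} y≡α))

ScalarMod : ℕ → SL2Z → Set
ScalarMod n γ = (+ n) Signed.∣ c γ × (+ n) Signed.∣ (a γ - d γ) × (+ n) Signed.∣ b γ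

∣u⇔scalarMod : ∀ {n} γ → n ∣ u γ ⇔ ScalarMod n γ
∣u⇔scalarMod {n} γ = mk⇔ ∣u⇒scalar scalar⇒∣u
  where
  ∣b∣≡ : ∣ - b γ ∣ ≡ ∣ b γ ∣
  ∣b∣≡ = ∣-i∣≡∣i∣ (b γ)

  ∣u⇒scalar : n ∣ u γ → ScalarMod n γ
  ∣u⇒scalar h with to ∣gcd³⇔ h
  ... | n∣c , n∣a-d , n∣-b = ∣ᵤ⇒∣ n∣c , ∣ᵤ⇒∣ n∣a-d , ∣ᵤ⇒∣ (subst (n ∣_) ∣b∣≡ n∣-b)

  scalar⇒∣u : ScalarMod n γ → n ∣ u γ
  scalar⇒∣u (n∣c , n∣a-d , n∣b) =
    from ∣gcd³⇔ (∣⇒∣ᵤ n∣c , ∣⇒∣ᵤ n∣a-d , subst (n ∣_) (sym ∣b∣≡) (∣⇒∣ᵤ n∣b))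

-- The determinant condition rewritten around the top-left entry; it is what
-- makes a² ≡ 1 (mod n) automatic for scalar matrices.
det-identity : ∀ γ → a γ * a γ - 1ℤ ≡ a γ * (a γ - d γ) + b γ * c γ
det-identity (mkSL2 a b c d det) = begin
  a * a - 1ℤ                ≡⟨ cong (λ t → a * a - t) (sym det) ⟩
  a * a - (a * d - b * c)   ≡⟨ solve 4 (λ a b c d → a :* a :- (a :* d :- b :* c)
                                                  := a :* (a :- d) :+ b :* c) refl a b c d ⟩
  a * (a - d) + b * c       ∎
  where open ≡-Reasoning

inGammaHat⇒scalarMod : ∀ {n} γ → InGammaHat n γ → ScalarMod n γ
inGammaHat⇒scalarMod γ (_ , _ , a≡α , b≡0 , c≡0 , d≡α) =
    to (congMod0⇔∣ {x = c γ}) c≡0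
  , congMod-common⇒∣ {x = a γ} {d γ} a≡α d≡α
  , to (congMod0⇔∣ {x = b γ}) b≡0

scalarMod⇒inGammaHat : ∀ {n} γ → ScalarMod n γ → InGammaHat n γ
scalarMod⇒inGammaHat {n} γ (n∣c , n∣a-d , n∣b) =
  a γ , a²≡1 , congMod-refl n (a γ) , from congMod0⇔∣ n∣b , from congMod0⇔∣ n∣c , d≡a
  where
  d≡a : CongMod n (d γ) (a γ)
  d≡a = congMod-sym {n} {a γ} {d γ} (from (congMod⇔∣ {n} {a γ} {d γ}) n∣a-d)

  a²≡1 : CongMod n (a γ * a γ) 1ℤ
  a²≡1 = from (congMod⇔∣ {n} {a γ * a γ} {1ℤ})
    (subst (+ n Signed.∣_) (sym (det-identity γ))
           (∣m∣n⇒∣m+n (∣n⇒∣m*n (a γ) n∣a-d) (∣n⇒∣m*n (b γ) n∣c)))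

lemma3 : (n : ℕ) → n ≥ 1 → (γ : SL2Z) → InGammaHat n γ ⇔ (n ∣ u γ)
lemma3 n _ γ = mk⇔
  (λ γ∈Γ̂ → from (∣u⇔scalarMod γ) (inGammaHat⇒scalarMod γ γ∈Γ̂))
  (λ n∣u → scalarMod⇒inGammaHat γ (to (∣u⇔scalarMod γ) n∣u))
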